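{- The linear map $\phi:SKPR\to \mathrm{QSym}$ defined by \[ \phi([[h]]) = \sum_{w\,\hat{\equiv}\, h} f_{\mathcal{D}(w)} \] is an algebra homomorphism.
   Context: The weak $K$-Knuth equivalence $\hat{\equiv}$ is the symmetric transitive closure of the relations (with $\mathbf{u},\mathbf{v}$ possibly empty and $a<b<c$): $\mathbf{u}aa\mathbf{v}\,\hat{\equiv}\,\mathbf{u}a\mathbf{v}$; $\mathbf{u}aba\mathbf{v}\,\hat{\equiv}\,\mathbf{u}bab\mathbf{v}$; $\mathbf{u}bac\mathbf{v}\,\hat{\equiv}\,\mathbf{u}bca\mathbf{v}$; $\mathbf{u}acb\mathbf{v}\,\hat{\equiv}\,\mathbf{u}cab\mathbf{v}$; $ab\mathbf{u}\,\hat{\equiv}\,ba\mathbf{u}$. For an initial word $h$ (letters exactly $[k]$), $[[h]]=\sum_{w\,\hat{\equiv}\,h} w$; $SKPR$ is the $\mathbb{R}$-span of these with product $[[h]]\cdot[[h']]=\sum_{w\,\hat{\equiv}\, h,\ w'\,\hat{\equiv}\, h'} w \mathbin{\sqcup\!\sqcup} w'[n]$ for $h$ in alphabet $[n]$, where $w'[n]$ increases each letter by $n$ and $\mathbin{\sqcup\!\sqcup}$ is the shuffle product. The descent set of $w=w_1\cdots w_n$ is $\mathcal{D}(w)=\{i: w_i>w_{i+1}\}$, and for $\mathcal{D}\subset[n-1]$ the fundamental quasisymmetric function is $f_{\mathcal{D}}=\sum x_{i_1}\cdots x_{i_n}$ over $i_1\le\cdots\le i_n$ with $i_j<i_{j+1}$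 whenever $j\in\mathcal{D}$. -}

module Defs where

open import Data.Nat using (ℕ; zero; suc; _+_; _*_; _∸_; _≤_; _<_; _<ᵇ_; _≡ᵇ_)
open import Data.Bool using (Bool; true; false; _∧_; if_then_else_)
open import Data.List using (List; []; _∷_; _++_; map; concatMap; upTo; length; replicate)
open import Data.List.Membership.Propositional using (_∈_)
open import Data.Product using (_×_; _,_; proj₁; proj₂)
open import Relation.Binary.Construct.Closure.Equivalence using (EqClosure)
open import Relation.Nullary using (Dec; does)
open import Data.Nat.ListAction using (sum)

-- Words over positive integers (letters 1,2,3,...).
Word : Set
Word = List ℕ

data KStep : Word → Word → Set where
  idem   : ∀ u v a → KStep (u ++ a ∷ a ∷ v) (u ++ a ∷ v)
  braid  : ∀ u v a b → a < b → KStep (u ++ a ∷ b ∷ a ∷ v) (u ++ b ∷ a ∷ b ∷ v)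
  knuth1 : ∀ u v a b c → a < b → b < c → KStep (u ++ b ∷ a ∷ c ∷ v) (u ++ b ∷ c ∷ a ∷ v)
  knuth2 : ∀ u v a b c → a < b → b < c → KStep (u ++ a ∷ c ∷ b ∷ v) (u ++ c ∷ a ∷ b ∷ v)
  front  : ∀ u a b → a < b → KStep (a ∷ b ∷ u) (b ∷ a ∷ u)

_≈K_ : Word → Word → Set
_≈K_ = EqClosure KStep

Initial : ℕ → Word → Set
Initial k h = ∀ a → (a ∈ h → (1 ≤ a × a ≤ k)) × (1 ≤ a → a ≤ k → a ∈ h)

wordsOf : ℕ → ℕ → List Word
wordsOf N zero = [] ∷ []
wordsOf N (suc m) = concatMap (λ a → map (a ∷_) (wordsOf N m)) (map suc (upTo N))

shuffles : Word → Word → List Word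
shuffles [] v = v ∷ []
shuffles (x ∷ u) [] = (x ∷ u) ∷ []
shuffles (x ∷ u) (y ∷ v) = map (x ∷_) (shuffles u (y ∷ v)) ++ map (y ∷_) (shuffles (x ∷ u) v)

shift : ℕ → Word → Word
shift n w = map (_+ n) w

descentsFrom : ℕ → Word → List ℕ
descentsFrom i (x ∷ y ∷ w) = (if y <ᵇ x then i ∷ [] else []) ++ descentsFrom (suc i) (y ∷ w)
descentsFrom i _ = []

descents : Word → List ℕ
descents w = descentsFrom 1 w

-- Formal power series in x_1, x_2, ... with ℕ coefficients.
-- A monomial x_1^{e_1} x_2^{e_2} ... x_r^{e_r} is its exponent list (e_1 ∷ ... ∷ e_r).
Mono : Set
Mono = List ℕ

Series : Set
Series = Mono → ℕ

expandFrom : ℕ → Mono → List ℕ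
expandFrom j [] = []
expandFrom j (e ∷ α) = replicate e j ++ expandFrom (suc j) α

indexSeq : Mono → List ℕ
indexSeq α = expandFrom 1 α

-- 1-based lookup with default 0.
at : List ℕ → ℕ → ℕ
at (x ∷ s) (suc zero) = x
at (x ∷ s) (suc (suc i)) = at s (suc i)
at _ _ = 0

allB : (ℕ → Bool) → List ℕ → Bool
allB p [] = true
allB p (x ∷ xs) = p x ∧ allB p xs

-- Fundamental quasisymmetric function f_D of degree n:
-- coefficient of x_{i_1}...x_{i_n} (i_1 ≤ ... ≤ i_n) is 1 iff i_j < i_{j+1} for all j ∈ D.
fund : ℕ → List ℕ → Series
fund n D α =
  if (length (indexSeq α) ≡ᵇ n) ∧ allB (λ j → at (indexSeq α) j <ᵇ at (indexSeq α) (suc j)) D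
  then 1 else 0

-- Product of series: coefficient of x^α is Σ_{β+γ=α} A_β B_γ.
splits : Mono → List (Mono × Mono)
splits [] = ([] , []) ∷ []
splits (e ∷ α) =
  concatMap (λ b → map (λ p → (b ∷ proj₁ p , (e ∸ b) ∷ proj₂ p)) (splits α)) (upTo (suc e))

_⊗_ : Series → Series → Series
(A ⊗ B) α = sum (map (λ p → A (proj₁ p) * B (proj₂ p)) (splits α))

oneS : Series
oneS α = if length (indexSeq α) ≡ᵇ 0 then 1 else 0

-- Everything below is parametrised by a decision procedure for ≈K,
-- used only to compute the (finite) coefficients of the infinite sums.
module WithDecider (dec : (u v : Word) → Dec (u ≈K v)) where

  ind : Word → Word → ℕ
  ind w h = if does (dec w h) then 1 else 0

  -- φ([[h]]) = Σ_{w ≈K h} f_{D(w)}, for h in alphabet [k].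
  -- Coefficient of x^α only receives contributions from words of length |α|.
  φ : ℕ → Word → Series
  φ k h α = sum (map (λ w → ind w h * fund (length (indexSeq α)) (descents w) α)
                     (wordsOf k (length (indexSeq α))))

  -- φ applied to [[h]]·[[h']] = Σ_{w ≈K h, w' ≈K h'} w ⧢ w'[k]
  -- (φ extended linearly: a word u ↦ f_{D(u)}), for h in alphabet [k], h' in [k'].
  φprod : ℕ → Word → ℕ → Word → Series
  φprod k h k' h' α =
    sum (map (λ p →
      sum (map (λ w →
        sum (map (λ w' →
          ind w h * ind w' h' *
          sum (map (λ u → fund m (descents u) α) (shuffles w (shift k w'))))
          (wordsOf k' (m ∸ p))))
        (wordsOf k p)))
      (upTo (suc m)))
    where m = length (indexSeq α)

-- For a word w let F_w be the fundamental quasisymmetric function of its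
-- descent set.  A monomial x^α is counted by F_w exactly when w cuts into
-- consecutive weakly increasing blocks of lengths α₁, α₂, ….  If every
-- letter of w is smaller than every letter of v, a weakly increasing block of
-- a shuffle of w and v is a block of w followed by a block of v, and the rest
-- is again a shuffle of the remainders; hence F_w F_v is the sum of F_u over
-- the shuffles u of w and v.  As the letters of w'[n] exceed n, φ([[h]]·[[h']])
-- and φ([[h]]) φ([[h']]) are the same bilinear combination of these products,
-- for arbitrary weights in place of the indicators of the classes of h, h'.
module Submission where

open import Algebra using (CommutativeMonoid)
import Algebra.Properties.CommutativeSemigroup as CommSemigroupProperties
open import Data.Bool using (Bool; true; false; _∧_; if_then_else_; T)
open import Data.Bool.Properties using (T-≡; ∧-commutativeMonoid; ∧-assoc; ∧-identityʳ)
open import Data.Empty using (⊥-elim)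
open import Data.List using (List; []; _∷_; _++_; map; concatMap; upTo; length; replicate; drop)
open import Data.List.Properties using (map-++; map-∘; map-cong; map-cong-local; map-upTo; map-applyUpTo; length-map; length-++; length-replicate)
open import Data.List.Relation.Unary.All using (All; []; _∷_)
import Data.List.Relation.Unary.All as All
import Data.List.Relation.Unary.All.Properties as All
open import Data.Nat using (ℕ; zero; suc; _+_; _*_; _∸_; _≤_; _<_; _<ᵇ_; _≤ᵇ_; _≡ᵇ_; z≤n; s≤s; z<s)
open import Data.Nat.ListAction using (sum)
open import Data.Nat.ListAction.Properties using (sum-++)
open import Data.Nat.Properties
open import Data.Nat.Tactic.RingSolver using (solve-∀)
open import Data.Product using (_×_; _,_; proj₁; proj₂)
open import Function using (_∘_; id; Equivalence)
open import Relation.Binary.Construct.Closure.ReflexiveTransitive using (ε)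
open import Relation.Binary.PropositionalEquality
open import Relation.Nullary using (Dec; yes; no)
open import Defs

open CommSemigroupProperties +-commutativeSemigroup using () renaming (interchange to +-interchange)
open CommSemigroupProperties *-commutativeSemigroup using () renaming (interchange to *-interchange)
open CommSemigroupProperties (CommutativeMonoid.commutativeSemigroup ∧-commutativeMonoid) using () renaming (x∙yz≈y∙xz to ∧-left-comm)

∑ : {A : Set} → List A → (A → ℕ) → ℕ
∑ xs f = sum (map f xs)

∑-syntax : {A : Set} → List A → (A → ℕ) → ℕ
∑-syntax = ∑

infix 2 ∑-syntax
syntax ∑-syntax xs (λ x → e) = ∑[ x ∈ xs ] e

module _ {A : Set} where

  ∑-cong : {f g : A → ℕ} → (∀ x → f x ≡ g x) → ∀ xs → ∑ xs f ≡ ∑ xs g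
  ∑-cong f≗g xs = cong sum (map-cong f≗g xs)

  ∑-cong-All : {P : A → Set} {f g : A → ℕ} {xs : List A} →
               All P xs → (∀ {x} → P x → f x ≡ g x) → ∑ xs f ≡ ∑ xs g
  ∑-cong-All ps f≗g = cong sum (map-cong-local (All.map f≗g ps))

  ∑-0 : ∀ (xs : List A) → (∑[ x ∈ xs ] 0) ≡ 0
  ∑-0 []       = refl
  ∑-0 (x ∷ xs) = ∑-0 xs

  ∑-0-All : {P : A → Set} {f : A → ℕ} {xs : List A} →
            All P xs → (∀ {x} → P x → f x ≡ 0) → ∑ xs f ≡ 0
  ∑-0-All {xs = xs} ps f≡0 = trans (∑-cong-All ps f≡0) (∑-0 xs)

  ∑-++ : ∀ (f : A → ℕ) xs ys → ∑ (xs ++ ys) f ≡ ∑ xs f + ∑ ys f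
  ∑-++ f xs ys = trans (cong sum (map-++ f xs ys)) (sum-++ (map f xs) (map f ys))

  ∑-*ˡ : ∀ c (f : A → ℕ) xs → (∑[ x ∈ xs ] c * f x) ≡ c * ∑ xs f
  ∑-*ˡ c f []       = sym (*-zeroʳ c)
  ∑-*ˡ c f (x ∷ xs) = trans (cong (c * f x +_) (∑-*ˡ c f xs)) (sym (*-distribˡ-+ c (f x) _))

  ∑-*ʳ : ∀ c (f : A → ℕ) xs → (∑[ x ∈ xs ] f x * c) ≡ ∑ xs f * c
  ∑-*ʳ c f xs = trans (∑-cong (λ x → *-comm (f x) c) xs) (trans (∑-*ˡ c f xs) (*-comm c _))

  ∑-+ : ∀ (f g : A → ℕ) xs → (∑[ x ∈ xs ] f x + g x) ≡ ∑ xs f + ∑ xs g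
  ∑-+ f g []       = refl
  ∑-+ f g (x ∷ xs) = trans (cong (f x + g x +_) (∑-+ f g xs)) (+-interchange (f x) (g x) _ _)

module _ {A B : Set} where

  ∑-map : ∀ (f : B → ℕ) (g : A → B) xs → ∑ (map g xs) f ≡ ∑ xs (f ∘ g)
  ∑-map f g xs = cong sum (sym (map-∘ xs))

  ∑-concatMap : ∀ (f : B → ℕ) (g : A → List B) xs →
                ∑ (concatMap g xs) f ≡ (∑[ x ∈ xs ] ∑ (g x) f)
  ∑-concatMap f g []       = refl
  ∑-concatMap f g (x ∷ xs) =
    trans (∑-++ f (g x) (concatMap g xs)) (cong (∑ (g x) f +_) (∑-concatMap f g xs))

  ∑-comm : ∀ (f : A → B → ℕ) xs ys →
           (∑[ x ∈ xs ] ∑[ y ∈ ys ] f x y) ≡ (∑[ y ∈ ys ] ∑[ x ∈ xs ] f x y)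
  ∑-comm f []       ys = sym (∑-0 ys)
  ∑-comm f (x ∷ xs) ys =
    trans (cong (∑ ys (f x) +_) (∑-comm f xs ys)) (sym (∑-+ (f x) (λ y → ∑[ x ∈ xs ] f x y) ys))

  ∑-*-∑ : ∀ (f : A → ℕ) (g : B → ℕ) xs ys → ∑ xs f * ∑ ys g ≡ (∑[ x ∈ xs ] ∑[ y ∈ ys ] f x * g y)
  ∑-*-∑ f g xs ys = trans (sym (∑-*ʳ (∑ ys g) f xs)) (∑-cong (λ x → sym (∑-*ˡ (f x) g ys)) xs)

upTo-< : ∀ n → All (_< n) (upTo n)
upTo-< n = All.applyUpTo⁺₁ id n id

∑-upTo-suc : ∀ (f : ℕ → ℕ) n → ∑ (upTo (suc n)) f ≡ f 0 + ∑ (upTo n) (f ∘ suc)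
∑-upTo-suc f n = cong (f 0 +_) (cong sum (trans (map-applyUpTo suc f n) (sym (map-upTo (f ∘ suc) n))))

∑-upTo-single : ∀ (f : ℕ → ℕ) {n p} → p < n → (∀ {q} → q < n → q ≢ p → f q ≡ 0) →
                ∑ (upTo n) f ≡ f p
∑-upTo-single f {suc n} {zero} _ f≡0 =
  trans (∑-upTo-suc f n)
        (trans (cong (f 0 +_) (∑-0-All (upTo-< n) (λ q<n → f≡0 (s≤s q<n) λ ())))
               (+-identityʳ (f 0)))
∑-upTo-single f {suc n} {suc p} (s≤s p<n) f≡0 =
  trans (∑-upTo-suc f n)
        (cong₂ _+_ (f≡0 z<s λ ())
                   (∑-upTo-single (f ∘ suc) p<n (λ q<n q≢p → f≡0 (s≤s q<n) (q≢p ∘ suc-injective))))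

𝟙 : Bool → ℕ
𝟙 b = if b then 1 else 0

𝟙-∧ : ∀ a b → 𝟙 (a ∧ b) ≡ 𝟙 a * 𝟙 b
𝟙-∧ true  true  = refl
𝟙-∧ true  false = refl
𝟙-∧ false b     = refl

T⇒≡true : ∀ {b} → T b → b ≡ true
T⇒≡true = Equivalence.to T-≡

≡true⇒T : ∀ {b} → b ≡ true → T b
≡true⇒T = Equivalence.from T-≡

<ᵇ-irrefl : ∀ n → (n <ᵇ n) ≡ false
<ᵇ-irrefl zero    = refl
<ᵇ-irrefl (suc n) = <ᵇ-irrefl n

≤ᵇ-true : ∀ {m n} → m ≤ n → (m ≤ᵇ n) ≡ true
≤ᵇ-true m≤n = T⇒≡true (≤⇒≤ᵇ m≤n)

≤ᵇ-false : ∀ {m n} → n < m → (m ≤ᵇ n) ≡ false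
≤ᵇ-false {m} {n} n<m with m ≤ᵇ n in eq
... | false = refl
... | true  = ⊥-elim (<⇒≱ n<m (≤ᵇ⇒≤ m n (≡true⇒T eq)))

≤ᵇ-sound : ∀ {m n} → (m ≤ᵇ n) ≡ true → m ≤ n
≤ᵇ-sound {m} {n} eq = ≤ᵇ⇒≤ m n (≡true⇒T eq)

if-<ᵇ-false-true : ∀ m n → (if n <ᵇ m then false else true) ≡ (m ≤ᵇ n)
if-<ᵇ-false-true zero    n       = refl
if-<ᵇ-false-true (suc m) zero    = refl
if-<ᵇ-false-true (suc m) (suc n) = trans (if-<ᵇ-false-true m n) (≤ᵇ-suc m n)
  where
  ≤ᵇ-suc : ∀ m n → (m ≤ᵇ n) ≡ (suc m ≤ᵇ suc n)
  ≤ᵇ-suc zero    n = refl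
  ≤ᵇ-suc (suc m) n = refl

risesAtDescents : Word → List ℕ → Bool
risesAtDescents (x ∷ y ∷ w) s =
  (if y <ᵇ x then at s 1 <ᵇ at s 2 else true) ∧ risesAtDescents (y ∷ w) (drop 1 s)
risesAtDescents _ s = true

compatible : Word → List ℕ → Bool
compatible w s = (length s ≡ᵇ length w) ∧ risesAtDescents w s

at-drop : ∀ i s n → at (drop i s) (suc n) ≡ at s (suc (n + i))
at-drop zero    s       n = cong (at s ∘ suc) (sym (+-identityʳ n))
at-drop (suc i) []      n = refl
at-drop (suc i) (x ∷ s) n = trans (at-drop i s n) (cong (at (x ∷ s) ∘ suc) (sym (+-suc n i)))

drop-suc : ∀ i (s : List ℕ) → drop 1 (drop i s) ≡ drop (suc i) s
drop-suc zero    s       = refl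
drop-suc (suc i) []      = refl
drop-suc (suc i) (x ∷ s) = drop-suc i s

allB-++ : ∀ p xs ys → allB p (xs ++ ys) ≡ allB p xs ∧ allB p ys
allB-++ p []       ys = refl
allB-++ p (x ∷ xs) ys = trans (cong (p x ∧_) (allB-++ p xs ys)) (sym (∧-assoc (p x) _ _))

allB-descentsFrom : ∀ s i w →
  allB (λ j → at s j <ᵇ at s (suc j)) (descentsFrom (suc i) w) ≡ risesAtDescents w (drop i s)
allB-descentsFrom s i []          = refl
allB-descentsFrom s i (x ∷ [])    = refl
allB-descentsFrom s i (x ∷ y ∷ w) =
  trans (allB-++ rises (if y <ᵇ x then suc i ∷ [] else []) (descentsFrom (suc (suc i)) (y ∷ w)))
        (cong₂ _∧_ head (trans (allB-descentsFrom s (suc i) (y ∷ w))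
                               (cong (risesAtDescents (y ∷ w)) (sym (drop-suc i s)))))
  where
  rises = λ j → at s j <ᵇ at s (suc j)
  head : allB rises (if y <ᵇ x then suc i ∷ [] else [])
       ≡ (if y <ᵇ x then at (drop i s) 1 <ᵇ at (drop i s) 2 else true)
  head with y <ᵇ x
  ... | true  = trans (∧-identityʳ _) (sym (cong₂ _<ᵇ_ (at-drop i s 0) (at-drop i s 1)))
  ... | false = refl

-- sortedPrefix lo e u is false when u has fewer than e letters.
sortedPrefix : ℕ → ℕ → Word → Bool
sortedPrefix lo zero    u       = true
sortedPrefix lo (suc e) []      = false
sortedPrefix lo (suc e) (x ∷ u) = (lo ≤ᵇ x) ∧ sortedPrefix x e u

fits : Word → Mono → Bool
fits w       (e ∷ α) = sortedPrefix 0 e w ∧ fits (drop e w) α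
fits []      []      = true
fits (_ ∷ _) []      = false

compatible-block : ∀ j e t w → All (j <_) t →
  compatible w (replicate e j ++ t) ≡ sortedPrefix 0 e w ∧ compatible (drop e w) t
compatible-block j zero          t       w           _ = refl
compatible-block j (suc e)       t       []          _ = refl
compatible-block j (suc zero)    t       (x ∷ [])    _ = refl
compatible-block j (suc (suc e)) t       (x ∷ [])    _ = refl
compatible-block j (suc zero)    []      (x ∷ y ∷ w) _ = refl
compatible-block j (suc zero)    (b ∷ t) (x ∷ y ∷ w) (j<b ∷ _)
  rewrite T⇒≡true (<⇒<ᵇ j<b) with y <ᵇ x
... | true  = refl
... | false = refl
compatible-block j (suc (suc e)) t       (x ∷ y ∷ w) j<t = begin
    A ∧ ((if y <ᵇ x then j <ᵇ j else true) ∧ C)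
  ≡⟨ cong (λ b → A ∧ (b ∧ C)) (trans (cong (λ b → if y <ᵇ x then b else true) (<ᵇ-irrefl j))
                                     (if-<ᵇ-false-true x y)) ⟩
    A ∧ ((x ≤ᵇ y) ∧ C)
  ≡⟨ ∧-left-comm A (x ≤ᵇ y) C ⟩
    (x ≤ᵇ y) ∧ (A ∧ C)
  ≡⟨ cong ((x ≤ᵇ y) ∧_) (compatible-block j (suc e) t (y ∷ w) j<t) ⟩
    (x ≤ᵇ y) ∧ (sortedPrefix y e w ∧ compatible (drop e w) t)
  ≡⟨ sym (∧-assoc (x ≤ᵇ y) _ _) ⟩
    sortedPrefix 0 (suc (suc e)) (x ∷ y ∷ w) ∧ compatible (drop e w) t
  ∎
  where
  open ≡-Reasoning
  A = length (replicate e j ++ t) ≡ᵇ length w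
  C = risesAtDescents (y ∷ w) (replicate (suc e) j ++ t)

expandFrom-≥ : ∀ i α → All (i ≤_) (expandFrom i α)
expandFrom-≥ i []      = []
expandFrom-≥ i (e ∷ α) = block e (All.map (≤-trans (n≤1+n i)) (expandFrom-≥ (suc i) α))
  where
  block : ∀ e {t} → All (i ≤_) t → All (i ≤_) (replicate e i ++ t)
  block zero    i≤t = i≤t
  block (suc e) i≤t = ≤-refl ∷ block e i≤t

compatible-expandFrom : ∀ j w α → compatible w (expandFrom j α) ≡ fits w α
compatible-expandFrom j []      []      = refl
compatible-expandFrom j (x ∷ w) []      = refl
compatible-expandFrom j w       (e ∷ α) =
  trans (compatible-block j e (expandFrom (suc j) α) w (expandFrom-≥ (suc j) α))
        (cong (sortedPrefix 0 e w ∧_) (compatible-expandFrom (suc j) (drop e w) α))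

deg : Mono → ℕ
deg α = length (indexSeq α)

fundOf : Word → Series
fundOf w = fund (length w) (descents w)

fundOf≡fits : ∀ w α → fundOf w α ≡ 𝟙 (fits w α)
fundOf≡fits w α =
  trans (cong (λ b → 𝟙 ((deg α ≡ᵇ length w) ∧ b)) (allB-descentsFrom (indexSeq α) 0 w))
        (cong 𝟙 (compatible-expandFrom 1 w α))

<ᵇ-+ʳ : ∀ k m n → (m + k <ᵇ n + k) ≡ (m <ᵇ n)
<ᵇ-+ʳ zero    m n = cong₂ _<ᵇ_ (+-identityʳ m) (+-identityʳ n)
<ᵇ-+ʳ (suc k) m n = trans (cong₂ _<ᵇ_ (+-suc m k) (+-suc n k)) (<ᵇ-+ʳ k m n)

descentsFrom-shift : ∀ k i w → descentsFrom i (shift k w) ≡ descentsFrom i w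
descentsFrom-shift k i []          = refl
descentsFrom-shift k i (x ∷ [])    = refl
descentsFrom-shift k i (x ∷ y ∷ w) =
  cong₂ _++_ (cong (λ b → if b then i ∷ [] else []) (<ᵇ-+ʳ k y x))
             (descentsFrom-shift k (suc i) (y ∷ w))

fundOf-shift : ∀ k w γ → fundOf (shift k w) γ ≡ fundOf w γ
fundOf-shift k w γ = cong₂ (λ n D → fund n D γ) (length-map (_+ k) w) (descentsFrom-shift k 1 w)

Homogeneous : ℕ → Series → Set
Homogeneous p A = ∀ β → p ≢ deg β → A β ≡ 0

fundOf-homogeneous : ∀ w → Homogeneous (length w) (fundOf w)
fundOf-homogeneous w β w≢β with deg β ≡ᵇ length w in eq
... | false = refl
... | true  = ⊥-elim (w≢β (sym (≡ᵇ⇒≡ _ _ (≡true⇒T eq))))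

shuffles-[] : ∀ w → shuffles w [] ≡ w ∷ []
shuffles-[] []      = refl
shuffles-[] (x ∷ w) = refl

sortedPrefix-bound : ∀ {lo lo' y} n v → lo ≤ y → lo' ≤ y →
                     sortedPrefix lo n (y ∷ v) ≡ sortedPrefix lo' n (y ∷ v)
sortedPrefix-bound zero    v _    _     = refl
sortedPrefix-bound (suc n) v lo≤y lo'≤y =
  cong (_∧ sortedPrefix _ n v) (trans (≤ᵇ-true lo≤y) (sym (≤ᵇ-true lo'≤y)))

sortedPrefix-descent : ∀ {x y} n w → x < y → sortedPrefix y (suc n) (x ∷ w) ≡ false
sortedPrefix-descent n w x<y = cong (_∧ sortedPrefix _ n w) (≤ᵇ-false x<y)

module _ (g : Word → ℕ) where

  prefixTerm : ℕ → ℕ → Word → Word → ℕ → ℕ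
  prefixTerm lo e w v b =
    𝟙 (sortedPrefix lo b w) * 𝟙 (sortedPrefix lo (e ∸ b) v) *
    (∑[ u ∈ shuffles (drop b w) (drop (e ∸ b) v) ] g u)

  -- Since every letter of w is below every letter of v, a weakly increasing
  -- prefix of length e of a shuffle is b letters of w followed by e ∸ b of v.
  ∑-shuffles-sortedPrefix : ∀ {k} lo e w v → All (_≤ k) w → All (k <_) v →
    (∑[ u ∈ shuffles w v ] 𝟙 (sortedPrefix lo e u) * g (drop e u))
    ≡ ∑ (upTo (suc e)) (prefixTerm lo e w v)
  ∑-shuffles-sortedPrefix lo zero w v _ _ =
    trans (∑-cong (λ u → *-identityˡ (g u)) (shuffles w v))
          (sym (trans (+-identityʳ _) (*-identityˡ _)))
  ∑-shuffles-sortedPrefix lo (suc e) [] v _ _ =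
    trans (cong (_+ 0) (sym (cong₂ _*_ (*-identityˡ a) (+-identityʳ (g (drop (suc e) v))))))
          (sym (trans (∑-upTo-suc (prefixTerm lo (suc e) [] v) (suc e))
                      (cong (prefixTerm lo (suc e) [] v 0 +_) (∑-0 (upTo (suc e))))))
    where a = 𝟙 (sortedPrefix lo (suc e) v)
  ∑-shuffles-sortedPrefix lo (suc e) (x ∷ w) [] _ _ =
    sym (trans (∑-upTo-single (prefixTerm lo (suc e) (x ∷ w) []) ≤-refl only-last) last)
    where
    a = 𝟙 (sortedPrefix lo (suc e) (x ∷ w))
    only-last : ∀ {q} → q < suc (suc e) → q ≢ suc e → prefixTerm lo (suc e) (x ∷ w) [] q ≡ 0
    only-last {q} q<2+e q≢1+e
      rewrite +-∸-assoc 1 (≤-pred (≤∧≢⇒< (≤-pred q<2+e) q≢1+e)) = cong (_* ∑ (shuffles (drop q (x ∷ w)) []) g) (*-zeroʳ (𝟙 (sortedPrefix lo q (x ∷ w))))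
    last : prefixTerm lo (suc e) (x ∷ w) [] (suc e) ≡ a * g (drop e w) + 0
    last rewrite n∸n≡0 e | shuffles-[] (drop e w) =
      trans (cong₂ _*_ (*-identityʳ a) (+-identityʳ _)) (sym (+-identityʳ _))
  ∑-shuffles-sortedPrefix lo (suc e) (x ∷ w) (y ∷ v) (x≤k ∷ w≤k) (k<y ∷ k<v) = begin
      ∑ (map (x ∷_) xFirst ++ map (y ∷_) yFirst) P
    ≡⟨ ∑-++ P (map (x ∷_) xFirst) (map (y ∷_) yFirst) ⟩
      ∑ (map (x ∷_) xFirst) P + ∑ (map (y ∷_) yFirst) P
    ≡⟨ cong₂ _+_ (∑-cons x xFirst) (∑-cons y yFirst) ⟩
      𝟙 (lo ≤ᵇ x) * ∑ xFirst (Q x) + 𝟙 (lo ≤ᵇ y) * ∑ yFirst (Q y)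
    ≡⟨ cong₂ _+_ (cong (𝟙 (lo ≤ᵇ x) *_) (∑-shuffles-sortedPrefix x e w (y ∷ v) w≤k (k<y ∷ k<v)))
                 (cong (𝟙 (lo ≤ᵇ y) *_) (∑-shuffles-sortedPrefix y e (x ∷ w) v (x≤k ∷ w≤k) k<v)) ⟩
      𝟙 (lo ≤ᵇ x) * ∑ (upTo (suc e)) (prefixTerm x e w (y ∷ v))
        + 𝟙 (lo ≤ᵇ y) * ∑ (upTo (suc e)) (prefixTerm y e (x ∷ w) v)
    ≡⟨ +-comm (𝟙 (lo ≤ᵇ x) * ∑ (upTo (suc e)) (prefixTerm x e w (y ∷ v))) _ ⟩
      𝟙 (lo ≤ᵇ y) * ∑ (upTo (suc e)) (prefixTerm y e (x ∷ w) v)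
        + 𝟙 (lo ≤ᵇ x) * ∑ (upTo (suc e)) (prefixTerm x e w (y ∷ v))
    ≡⟨ cong₂ _+_ y-leads x-leads ⟩
      R 0 + ∑ (upTo (suc e)) (R ∘ suc)
    ≡⟨ ∑-upTo-suc R (suc e) ⟨
      ∑ (upTo (suc (suc e))) R
    ∎
    where
    open ≡-Reasoning
    x<y = ≤-<-trans x≤k k<y
    xFirst = shuffles w (y ∷ v)
    yFirst = shuffles (x ∷ w) v
    P = λ u → 𝟙 (sortedPrefix lo (suc e) u) * g (drop (suc e) u)
    Q = λ z u → 𝟙 (sortedPrefix z e u) * g (drop e u)
    R = prefixTerm lo (suc e) (x ∷ w) (y ∷ v)

    ∑-cons : ∀ z us → ∑ (map (z ∷_) us) P ≡ 𝟙 (lo ≤ᵇ z) * ∑ us (Q z)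
    ∑-cons z us =
      trans (∑-map P (z ∷_) us)
            (trans (∑-cong (λ u → trans (cong (_* g (drop e u)) (𝟙-∧ (lo ≤ᵇ z) (sortedPrefix z e u)))
                                        (*-assoc (𝟙 (lo ≤ᵇ z)) _ _)) us)
                   (∑-*ˡ (𝟙 (lo ≤ᵇ z)) (Q z) us))

    -- Once y leads, no letter of w may follow inside the prefix.
    y-leads : 𝟙 (lo ≤ᵇ y) * ∑ (upTo (suc e)) (prefixTerm y e (x ∷ w) v) ≡ R 0
    y-leads = begin
        𝟙 (lo ≤ᵇ y) * ∑ (upTo (suc e)) (prefixTerm y e (x ∷ w) v)
      ≡⟨ cong (𝟙 (lo ≤ᵇ y) *_) (trans (∑-upTo-suc (prefixTerm y e (x ∷ w) v) e)
                                       (cong (prefixTerm y e (x ∷ w) v 0 +_) no-x)) ⟩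
        𝟙 (lo ≤ᵇ y) * (1 * 𝟙 (sortedPrefix y e v) * S + 0)
      ≡⟨ arith (𝟙 (lo ≤ᵇ y)) (𝟙 (sortedPrefix y e v)) S ⟩
        1 * (𝟙 (lo ≤ᵇ y) * 𝟙 (sortedPrefix y e v)) * S
      ≡⟨ cong (λ n → 1 * n * S) (𝟙-∧ (lo ≤ᵇ y) (sortedPrefix y e v)) ⟨
        R 0
      ∎
      where
      S = ∑ (shuffles (x ∷ w) (drop e v)) g
      no-x : ∑ (upTo e) (prefixTerm y e (x ∷ w) v ∘ suc) ≡ 0
      no-x = trans (∑-cong (λ b → cong (λ c → 𝟙 c * 𝟙 (sortedPrefix y (e ∸ suc b) v)
                                               * ∑ (shuffles (drop b w) (drop (e ∸ suc b) v)) g)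
                                       (sortedPrefix-descent b w x<y)) (upTo e))
                   (∑-0 (upTo e))
      arith : ∀ c n S → c * (1 * n * S + 0) ≡ 1 * (c * n) * S
      arith = solve-∀

    x-leads : 𝟙 (lo ≤ᵇ x) * ∑ (upTo (suc e)) (prefixTerm x e w (y ∷ v)) ≡ ∑ (upTo (suc e)) (R ∘ suc)
    x-leads = trans (sym (∑-*ˡ (𝟙 (lo ≤ᵇ x)) (prefixTerm x e w (y ∷ v)) (upTo (suc e))))
                    (∑-cong step (upTo (suc e)))
      where
      step : ∀ b → 𝟙 (lo ≤ᵇ x) * prefixTerm x e w (y ∷ v) b ≡ R (suc b)
      step b with lo ≤ᵇ x in lo≤x
      ... | false = refl
      ... | true  = trans (*-identityˡ _)
                          (cong (λ c → 𝟙 (sortedPrefix x b w) * 𝟙 c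
                                       * ∑ (shuffles (drop b w) (drop (e ∸ b) (y ∷ v))) g)
                                (sortedPrefix-bound (e ∸ b) v (<⇒≤ x<y) (≤-trans (≤ᵇ-sound lo≤x) (<⇒≤ x<y))))

∑-shuffles-fits : ∀ {k} w v → All (_≤ k) w → All (k <_) v → ∀ α →
  (∑[ u ∈ shuffles w v ] 𝟙 (fits u α)) ≡ ((𝟙 ∘ fits w) ⊗ (𝟙 ∘ fits v)) α
∑-shuffles-fits []      []      _ _ [] = refl
∑-shuffles-fits []      (y ∷ v) _ _ [] = refl
∑-shuffles-fits (x ∷ w) []      _ _ [] = refl
∑-shuffles-fits (x ∷ w) (y ∷ v) _ _ [] =
  trans (∑-++ (λ u → 𝟙 (fits u [])) (map (x ∷_) xFirst) (map (y ∷_) yFirst))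
        (cong₂ _+_ (trans (∑-map (λ u → 𝟙 (fits u [])) (x ∷_) xFirst) (∑-0 xFirst))
                   (trans (∑-map (λ u → 𝟙 (fits u [])) (y ∷_) yFirst) (∑-0 yFirst)))
  where
  xFirst = shuffles w (y ∷ v)
  yFirst = shuffles (x ∷ w) v
∑-shuffles-fits w v w≤k k<v (e ∷ α) = begin
    (∑[ u ∈ shuffles w v ] 𝟙 (fits u (e ∷ α)))
  ≡⟨ ∑-cong (λ u → 𝟙-∧ (sortedPrefix 0 e u) (fits (drop e u) α)) (shuffles w v) ⟩
    (∑[ u ∈ shuffles w v ] 𝟙 (sortedPrefix 0 e u) * fitsα (drop e u))
  ≡⟨ ∑-shuffles-sortedPrefix fitsα 0 e w v w≤k k<v ⟩
    ∑ (upTo (suc e)) (prefixTerm fitsα 0 e w v)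
  ≡⟨ ∑-cong block (upTo (suc e)) ⟩
    (∑[ b ∈ upTo (suc e) ] ∑ (map (extend b) (splits α)) both)
  ≡⟨ ∑-concatMap both (λ b → map (extend b) (splits α)) (upTo (suc e)) ⟨
    ((𝟙 ∘ fits w) ⊗ (𝟙 ∘ fits v)) (e ∷ α)
  ∎
  where
  open ≡-Reasoning
  fitsα = λ u → 𝟙 (fits u α)
  both : Mono × Mono → ℕ
  both p = 𝟙 (fits w (proj₁ p)) * 𝟙 (fits v (proj₂ p))
  extend : ℕ → Mono × Mono → Mono × Mono
  extend b p = (b ∷ proj₁ p , (e ∸ b) ∷ proj₂ p)

  block : ∀ b → prefixTerm fitsα 0 e w v b ≡ ∑ (map (extend b) (splits α)) both
  block b = begin
      a * c * (∑[ u ∈ shuffles (drop b w) (drop (e ∸ b) v) ] fitsα u)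
    ≡⟨ cong (a * c *_) (∑-shuffles-fits (drop b w) (drop (e ∸ b) v)
                          (All.drop⁺ b w≤k) (All.drop⁺ (e ∸ b) k<v) α) ⟩
      a * c * ((𝟙 ∘ fits (drop b w)) ⊗ (𝟙 ∘ fits (drop (e ∸ b) v))) α
    ≡⟨ ∑-*ˡ (a * c) _ (splits α) ⟨
      (∑[ p ∈ splits α ] a * c * (𝟙 (fits (drop b w) (proj₁ p)) * 𝟙 (fits (drop (e ∸ b) v) (proj₂ p))))
    ≡⟨ ∑-cong split (splits α) ⟩
      ∑ (splits α) (both ∘ extend b)
    ≡⟨ ∑-map both (extend b) (splits α) ⟨
      ∑ (map (extend b) (splits α)) both
    ∎
    where
    a = 𝟙 (sortedPrefix 0 b w)
    c = 𝟙 (sortedPrefix 0 (e ∸ b) v)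
    split : ∀ p → a * c * (𝟙 (fits (drop b w) (proj₁ p)) * 𝟙 (fits (drop (e ∸ b) v) (proj₂ p)))
                ≡ both (extend b p)
    split p = trans (*-interchange a c _ _)
                    (sym (cong₂ _*_ (𝟙-∧ (sortedPrefix 0 b w) (fits (drop b w) (proj₁ p)))
                                    (𝟙-∧ (sortedPrefix 0 (e ∸ b) v) (fits (drop (e ∸ b) v) (proj₂ p)))))

⊗-cong : ∀ {A A' B B' : Series} → (∀ β → A β ≡ A' β) → (∀ γ → B γ ≡ B' γ) →
         ∀ α → (A ⊗ B) α ≡ (A' ⊗ B') α
⊗-cong A≗A' B≗B' α = ∑-cong (λ p → cong₂ _*_ (A≗A' (proj₁ p)) (B≗B' (proj₂ p))) (splits α)

fundOf-shuffle : ∀ {k} w v → All (_≤ k) w → All (k <_) v → ∀ α →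
  (∑[ u ∈ shuffles w v ] fundOf u α) ≡ (fundOf w ⊗ fundOf v) α
fundOf-shuffle w v w≤k k<v α =
  trans (∑-cong (λ u → fundOf≡fits u α) (shuffles w v))
        (trans (∑-shuffles-fits w v w≤k k<v α)
               (sym (⊗-cong (fundOf≡fits w) (fundOf≡fits v) α)))

⊗-∑ : ∀ {X Y : Set} (xs : List X) (ys : List Y) (a : X → ℕ) (b : Y → ℕ)
        (A : X → Series) (B : Y → Series) α →
      (∑[ x ∈ xs ] ∑[ y ∈ ys ] a x * b y * (A x ⊗ B y) α)
      ≡ ((λ β → ∑[ x ∈ xs ] a x * A x β) ⊗ (λ γ → ∑[ y ∈ ys ] b y * B y γ)) α
⊗-∑ xs ys a b A B α = begin
    (∑[ x ∈ xs ] ∑[ y ∈ ys ] a x * b y * (A x ⊗ B y) α)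
  ≡⟨ ∑-cong (λ x → ∑-cong (term x) ys) xs ⟩
    (∑[ x ∈ xs ] ∑[ y ∈ ys ] ∑[ p ∈ splits α ] F x y p)
  ≡⟨ ∑-cong (λ x → ∑-comm (F x) ys (splits α)) xs ⟩
    (∑[ x ∈ xs ] ∑[ p ∈ splits α ] ∑[ y ∈ ys ] F x y p)
  ≡⟨ ∑-comm (λ x p → ∑[ y ∈ ys ] F x y p) xs (splits α) ⟩
    (∑[ p ∈ splits α ] ∑[ x ∈ xs ] ∑[ y ∈ ys ] F x y p)
  ≡⟨ ∑-cong (λ p → ∑-*-∑ (λ x → a x * A x (proj₁ p)) (λ y → b y * B y (proj₂ p)) xs ys) (splits α) ⟨
    ((λ β → ∑[ x ∈ xs ] a x * A x β) ⊗ (λ γ → ∑[ y ∈ ys ] b y * B y γ)) α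
  ∎
  where
  open ≡-Reasoning
  F = λ x y p → a x * A x (proj₁ p) * (b y * B y (proj₂ p))
  term : ∀ x y → a x * b y * (A x ⊗ B y) α ≡ (∑[ p ∈ splits α ] F x y p)
  term x y = trans (sym (∑-*ˡ (a x * b y) _ (splits α)))
                   (∑-cong (λ p → *-interchange (a x) (b y) _ _) (splits α))

deg-expandFrom : ∀ j α → length (expandFrom j α) ≡ sum α
deg-expandFrom j []      = refl
deg-expandFrom j (e ∷ α) =
  trans (length-++ (replicate e j)) (cong₂ _+_ (length-replicate e) (deg-expandFrom (suc j) α))

splits-sum : ∀ α → All (λ p → sum (proj₁ p) + sum (proj₂ p) ≡ sum α) (splits α)
splits-sum []      = refl ∷ []
splits-sum (e ∷ α) =
  All.concat⁺ (All.map⁺ (All.applyUpTo⁺₁ id (suc e) λ {b} b<1+e →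
    All.map⁺ (All.map (λ {p} eq → trans (+-interchange b (sum (proj₁ p)) (e ∸ b) (sum (proj₂ p)))
                                        (cong₂ _+_ (m+[n∸m]≡n (≤-pred b<1+e)) eq))
                      (splits-sum α))))

splits-deg : ∀ α → All (λ p → deg (proj₁ p) + deg (proj₂ p) ≡ deg α) (splits α)
splits-deg α = All.map (λ {p} eq → trans (cong₂ _+_ (deg-expandFrom 1 (proj₁ p)) (deg-expandFrom 1 (proj₂ p)))
                                         (trans eq (sym (deg-expandFrom 1 α))))
                       (splits-sum α)

⊗-graded : ∀ (G G' : ℕ → Series) → (∀ p → Homogeneous p (G p)) → (∀ p → Homogeneous p (G' p)) →
  ∀ α → (∑[ p ∈ upTo (suc (deg α)) ] (G p ⊗ G' (deg α ∸ p)) α)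
        ≡ ((λ β → G (deg β) β) ⊗ (λ γ → G' (deg γ) γ)) α
⊗-graded G G' G-hom G'-hom α =
  trans (∑-comm (λ p q → G p (proj₁ q) * G' (m ∸ p) (proj₂ q)) (upTo (suc m)) (splits α))
        (∑-cong-All (splits-deg α) (λ {q} → only-deg (proj₁ q) (proj₂ q)))
  where
  m = deg α
  only-deg : ∀ β γ → deg β + deg γ ≡ m →
             (∑[ p ∈ upTo (suc m) ] G p β * G' (m ∸ p) γ) ≡ G (deg β) β * G' (deg γ) γ
  only-deg β γ eq =
    trans (∑-upTo-single (λ p → G p β * G' (m ∸ p) γ) (s≤s (subst (deg β ≤_) eq (m≤m+n (deg β) (deg γ))))
                         (λ {q} _ q≢β → cong (_* G' (m ∸ q) γ) (G-hom q β q≢β)))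
          (cong (λ n → G (deg β) β * G' n γ) (trans (cong (_∸ deg β) (sym eq)) (m+n∸m≡n (deg β) (deg γ))))

wordsOf-sound : ∀ N p → All (λ w → length w ≡ p × All (λ a → 1 ≤ a × a ≤ N) w) (wordsOf N p)
wordsOf-sound N zero    = (refl , []) ∷ []
wordsOf-sound N (suc p) =
  All.concat⁺ (All.map⁺ (All.map⁺ (All.applyUpTo⁺₁ id N λ a<N →
    All.map⁺ (All.map (λ (len , letters) → cong suc len , (s≤s z≤n , a<N) ∷ letters) (wordsOf-sound N p)))))

shuffles-length : ∀ w v → All (λ u → length u ≡ length w + length v) (shuffles w v)
shuffles-length []      v       = refl ∷ []
shuffles-length (x ∷ w) []      = sym (+-identityʳ _) ∷ []
shuffles-length (x ∷ w) (y ∷ v) =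
  All.++⁺ (All.map⁺ (All.map (cong suc) (shuffles-length w (y ∷ v))))
          (All.map⁺ (All.map (λ eq → trans (cong suc eq) (sym (+-suc (length (x ∷ w)) (length v))))
                             (shuffles-length (x ∷ w) v)))

-- φ and φprod of WithDecider are series and shuffleSeries with the weights w ↦ [w ≈K h].
series : ℕ → (Word → ℕ) → Series
series N c α = ∑[ w ∈ wordsOf N (deg α) ] c w * fund (deg α) (descents w) α

shuffleSeries : ℕ → (Word → ℕ) → ℕ → (Word → ℕ) → Series
shuffleSeries N c N' c' α =
  ∑[ p ∈ upTo (suc (deg α)) ] ∑[ w ∈ wordsOf N p ] ∑[ w' ∈ wordsOf N' (deg α ∸ p) ]
    c w * c' w' * (∑[ u ∈ shuffles w (shift N w') ] fund (deg α) (descents u) α)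

component : ℕ → (Word → ℕ) → ℕ → Series
component N c p β = ∑[ w ∈ wordsOf N p ] c w * fundOf w β

component-homogeneous : ∀ N c p → Homogeneous p (component N c p)
component-homogeneous N c p β p≢β =
  ∑-0-All (wordsOf-sound N p) λ {w} (len , _) →
    trans (cong (c w *_) (fundOf-homogeneous w β (λ eq → p≢β (trans (sym len) eq)))) (*-zeroʳ (c w))

series≡component : ∀ N c β → series N c β ≡ component N c (deg β) β
series≡component N c β =
  ∑-cong-All (wordsOf-sound N (deg β)) λ {w} (len , _) → cong (λ n → c w * fund n (descents w) β) (sym len)

shuffle-shift : ∀ N N' p α {w w'} → p ≤ deg α →
  length w ≡ p × All (λ a → 1 ≤ a × a ≤ N) w → length w' ≡ deg α ∸ p × All (λ a → 1 ≤ a × a ≤ N') w' →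
  (∑[ u ∈ shuffles w (shift N w') ] fund (deg α) (descents u) α) ≡ (fundOf w ⊗ fundOf w') α
shuffle-shift N N' p α {w} {w'} p≤m (len , letters) (len' , letters') =
  trans (∑-cong-All (shuffles-length w (shift N w'))
                    (λ {u} eq → cong (λ n → fund n (descents u) α) (sym (trans eq total))))
        (trans (fundOf-shuffle w (shift N w') (All.map proj₂ letters)
                               (All.map⁺ (All.map (λ (1≤a , _) → +-monoˡ-≤ N 1≤a) letters')) α)
               (⊗-cong {A = fundOf w} (λ _ → refl) (fundOf-shift N w') α))
  where
  total : length w + length (shift N w') ≡ deg α
  total = trans (cong₂ _+_ len (trans (length-map (_+ N) w') len')) (m+[n∸m]≡n p≤m)

series-shuffle : ∀ N c N' c' α → shuffleSeries N c N' c' α ≡ (series N c ⊗ series N' c') α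
series-shuffle N c N' c' α = begin
    shuffleSeries N c N' c' α
  ≡⟨ ∑-cong-All (upTo-< (suc m)) (λ {p} p<1+m →
       ∑-cong-All (wordsOf-sound N p) λ {w} wf →
       ∑-cong-All (wordsOf-sound N' (m ∸ p)) λ {w'} wf' →
       cong (c w * c' w' *_) (shuffle-shift N N' p α (≤-pred p<1+m) wf wf')) ⟩
    (∑[ p ∈ upTo (suc m) ] ∑[ w ∈ wordsOf N p ] ∑[ w' ∈ wordsOf N' (m ∸ p) ]
       c w * c' w' * (fundOf w ⊗ fundOf w') α)
  ≡⟨ ∑-cong (λ p → ⊗-∑ (wordsOf N p) (wordsOf N' (m ∸ p)) c c' fundOf fundOf α) (upTo (suc m)) ⟩
    (∑[ p ∈ upTo (suc m) ] (component N c p ⊗ component N' c' (m ∸ p)) α)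
  ≡⟨ ⊗-graded (component N c) (component N' c') (component-homogeneous N c) (component-homogeneous N' c') α ⟩
    ((λ β → component N c (deg β) β) ⊗ (λ γ → component N' c' (deg γ) γ)) α
  ≡⟨ ⊗-cong (series≡component N c) (series≡component N' c') α ⟨
    (series N c ⊗ series N' c') α
  ∎
  where
  open ≡-Reasoning
  m = deg α

fund-[] : ∀ α → fund 0 [] α ≡ oneS α
fund-[] α = cong 𝟙 (∧-identityʳ (deg α ≡ᵇ 0))

series-unit : ∀ c α → series 0 c α ≡ c [] * oneS α
series-unit c α = by-degree (deg α) refl
  where
  by-degree : ∀ L → L ≡ deg α → (∑[ w ∈ wordsOf 0 L ] c w * fund L (descents w) α) ≡ c [] * oneS α
  by-degree zero    _  = trans (+-identityʳ _) (cong (c [] *_) (fund-[] α))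
  by-degree (suc L) eq = sym (trans (cong (λ n → c [] * 𝟙 (n ≡ᵇ 0)) (sym eq)) (*-zeroʳ (c [])))

theorem4p8 : (dec : (u v : Word) → Dec (u ≈K v)) →
    ((k : ℕ) (h : Word) (k' : ℕ) (h' : Word) → Initial k h → Initial k' h' →
      (α : Mono) → WithDecider.φprod dec k h k' h' α ≡ (WithDecider.φ dec k h ⊗ WithDecider.φ dec k' h') α)
    × ((α : Mono) → WithDecider.φ dec 0 [] α ≡ oneS α)
theorem4p8 dec =
  (λ k h k' h' _ _ → series-shuffle k (λ w → ind w h) k' (λ w → ind w h')) ,
  (λ α → trans (series-unit (λ w → ind w []) α) (trans (cong (_* oneS α) ind-[]) (*-identityˡ (oneS α))))
  where
  open WithDecider dec
  ind-[] : ind [] [] ≡ 1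
  ind-[] with dec [] []
  ... | yes _  = refl
  ... | no ¬≈ = ⊥-elim (¬≈ ε)
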